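{- Let $p$ be a prime and $f\in\mathbb{F}_p[x]$ a nonconstant polynomial of degree smaller than $p$. If $h\in\mathbb{F}_p$ with $h\ne 0$, then the affine plane curve $\{(x,y): f(x)-(f(y)+h)=0\}$ is absolutely irreducible. -}

module Defs where

open import Level using (Level; _⊔_)
open import Data.Nat as ℕ using (ℕ; zero; suc; _∸_; _<?_; _≟_)
open import Data.Fin using (Fin; toℕ; fromℕ<)
open import Data.Product using (Σ; ∃; _×_; _,_)
open import Relation.Nullary using (¬_; yes; no)
open import Relation.Binary.PropositionalEquality using (_≡_)
open import Algebra.Bundles using (CommutativeRing)

record Field (c ℓ : Level) : Set (Level.suc (c ⊔ ℓ)) where
  field
    commRing : CommutativeRing c ℓ
  open CommutativeRing commRing public
  field
    1≉0 : ¬ (1# ≈ 0#)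
    inverse : ∀ x → ¬ (x ≈ 0#) → ∃ λ y → x * y ≈ 1#

module FieldOps {c ℓ} (K : Field c ℓ) where
  open Field K

  pow : Carrier → ℕ → Carrier
  pow x zero = 1#
  pow x (suc n) = x * pow x n

  sumTo : ℕ → (ℕ → Carrier) → Carrier
  sumTo zero g = 0#
  sumTo (suc n) g = sumTo n g + g n

  ι : ℕ → Carrier
  ι zero = 0#
  ι (suc n) = 1# + ι n

  AlgClosed : Set (c ⊔ ℓ)
  AlgClosed = ∀ (n : ℕ) (a : ℕ → Carrier) →
    ∃ λ x → (pow x (suc n) + sumTo (suc n) (λ i → a i * pow x i)) ≈ 0#

  -- bivariate polynomials in K[x,y]: coefficient of x^i y^j, finitely supported
  record Poly2 : Set (c ⊔ ℓ) where
    field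
      bound : ℕ
      cf : Fin (suc bound) → Fin (suc bound) → Carrier
  open Poly2 public

  coeff : Poly2 → ℕ → ℕ → Carrier
  coeff F i j with i <? suc (bound F) | j <? suc (bound F)
  ... | yes i< | yes j< = cf F (fromℕ< i<) (fromℕ< j<)
  ... | _ | _ = 0#

  _≈P_ : Poly2 → Poly2 → Set ℓ
  F ≈P G = ∀ i j → coeff F i j ≈ coeff G i j

  mulCoeff : Poly2 → Poly2 → ℕ → ℕ → Carrier
  mulCoeff G H i j =
    sumTo (suc i) (λ a → sumTo (suc j) (λ b →
      coeff G a b * coeff H (i ∸ a) (j ∸ b)))

  IsProduct : Poly2 → Poly2 → Poly2 → Set ℓ
  IsProduct F G H = ∀ i j → coeff F i j ≈ mulCoeff G H i j

  Nonconstant : Poly2 → Set ℓ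
  Nonconstant F = ∃ λ i → ∃ λ j → ¬ (i ≡ 0 × j ≡ 0) × ¬ (coeff F i j ≈ 0#)

  -- irreducible in K[x,y]: not a unit or zero (i.e. nonconstant), and in every
  -- factorization F = G * H one of the factors is constant (a unit)
  Irreducible : Poly2 → Set (c ⊔ ℓ)
  Irreducible F = Nonconstant F ×
    (∀ G H → IsProduct F G H → ¬ (Nonconstant G × Nonconstant H))

  -- The polynomial f(x) - (f(y) + h) ∈ K[x,y], where f ∈ F_p[x] of degree < p
  -- is given by its coefficients a : Fin p → Fin p (a i = coefficient of x^i,
  -- F_p = Fin p = residues 0..p-1) and h ∈ F_p; F_p → K via n ↦ n·1.
  module Curve (p : ℕ) (a : Fin p → Fin p) (h : Fin p) where
    fcoeff : ℕ → Carrier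
    fcoeff i with i <? p
    ... | yes i<p = ι (toℕ (a (fromℕ< i<p)))
    ... | no _ = 0#

    isZero : ℕ → Carrier → Carrier
    isZero i v with i ≟ 0
    ... | yes _ = v
    ... | no _ = 0#

    curveCoeff : ℕ → ℕ → Carrier
    curveCoeff i j =
      isZero j (fcoeff i) - (isZero i (fcoeff j) + isZero i (isZero j (ι (toℕ h))))

    -- all coefficients with i ≥ p or j ≥ p vanish, so the box [0,p]² suffices
    curve : Poly2
    curve = record { bound = p ; cf = λ i j → curveCoeff (toℕ i) (toℕ j) }

module Submission where

-- Let F = f(x) − f(y) − h and suppose F = G H with G, H nonconstant. On the diagonal x = y = t
-- we get F(t,t) = −h, a nonzero constant, so G(t,t) and H(t,t) are constants too; in particular
-- the leading homogeneous components G_m and H_n (m, n ≥ 1) vanish at (1,1), and by the Leibniz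
-- rule so does ∂ₓ(G_m H_n). But G_m H_n = F_(m+n) = a_(m+n) (x^(m+n) − y^(m+n)) is nonzero, which
-- forces m + n < p, and then ∂ₓF_(m+n)(1,1) = (m + n) a_(m+n) ≠ 0 in characteristic p.

open import Defs
open import Level using (Level)
open import Data.Nat as ℕ using (ℕ; zero; suc; _≤_; _<_; z≤n; s≤s; _≟_; NonZero)
open import Data.Nat.Properties as ℕ
  using (≤-refl; ≤-pred; m≤n⇒m<n∨m≡n; m<n⇒m<1+n; <⇒≢; ≤-total)
open import Data.Nat.Coprimality using (prime⇒coprime; coprime-Bézout)
open import Data.Nat.GCD using (module Bézout)
open import Data.Nat.Primality using (Prime)
open import Data.Fin using (Fin; toℕ)
open import Data.Fin.Properties using (fromℕ<-toℕ; toℕ-fromℕ<; toℕ<n)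
open import Data.Product using (∃; _×_; _,_)
open import Data.Sum using (_⊎_; inj₁; inj₂; [_,_])
open import Relation.Binary.Definitions using (tri<; tri≈; tri>)
open import Data.Empty using (⊥; ⊥-elim)
open import Relation.Nullary using (¬_; Dec; yes; no)
open import Relation.Nullary.Decidable using (¬¬-excluded-middle; decidable-stable)
open import Relation.Binary.PropositionalEquality as ≡ using (_≡_)
open import Function using (_∘_)

¬¬-all-or-lastFailure : ∀ {z} (Z : ℕ → Set z) R → (∀ k → R ≤ k → Z k) →
  ¬ ¬ ((∀ k → Z k) ⊎ ∃ λ m → ¬ Z m × (∀ k → m < k → Z k))
¬¬-all-or-lastFailure Z zero Z≥0 ¬goal = ¬goal (inj₁ (λ k → Z≥0 k z≤n))
¬¬-all-or-lastFailure Z (suc R) Z>R ¬goal = ¬¬-excluded-middle (λ where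
  (no ¬ZR) → ¬goal (inj₂ (R , ¬ZR , Z>R))
  (yes ZR) → ¬¬-all-or-lastFailure Z R (Z≥ ZR) ¬goal)
  where
  Z≥ : Z R → ∀ k → R ≤ k → Z k
  Z≥ ZR k R≤k with m≤n⇒m<n∨m≡n R≤k
  ... | inj₁ R<k = Z>R k R<k
  ... | inj₂ ≡.refl = ZR

<-by-contraposition : ∀ {p} {P : Set p} {k R} → (R ≤ k → P) → ¬ P → k < R
<-by-contraposition {k = k} {R} R≤k⇒P ¬P = decidable-stable (k ℕ.<? R) (¬P ∘ R≤k⇒P ∘ ℕ.≮⇒≥)

module FiniteSums {c ℓ} (K : Field c ℓ) where
  open Field K
  open FieldOps K
  open import Relation.Binary.Reasoning.Setoid setoid
  open import Algebra.Properties.CommutativeSemigroup +-commutativeSemigroup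
    using () renaming (interchange to +-interchange)

  zeroˡ′ : ∀ {x} y → x ≈ 0# → x * y ≈ 0#
  zeroˡ′ y x≈0 = trans (*-cong x≈0 refl) (zeroˡ y)

  zeroʳ′ : ∀ x {y} → y ≈ 0# → x * y ≈ 0#
  zeroʳ′ x y≈0 = trans (*-cong refl y≈0) (zeroʳ x)

  +-≈0 : ∀ {x y} → x ≈ 0# → y ≈ 0# → x + y ≈ 0#
  +-≈0 x≈0 y≈0 = trans (+-cong x≈0 y≈0) (+-identityʳ 0#)

  sumTo-cong< : ∀ n {f g : ℕ → Carrier} → (∀ i → i < n → f i ≈ g i) → sumTo n f ≈ sumTo n g
  sumTo-cong< zero eq = refl
  sumTo-cong< (suc n) eq = +-cong (sumTo-cong< n (λ i i<n → eq i (m<n⇒m<1+n i<n))) (eq n ≤-refl)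

  sumTo-cong : ∀ n {f g : ℕ → Carrier} → (∀ i → f i ≈ g i) → sumTo n f ≈ sumTo n g
  sumTo-cong n eq = sumTo-cong< n (λ i _ → eq i)

  sumTo-zero : ∀ n {f : ℕ → Carrier} → (∀ i → i < n → f i ≈ 0#) → sumTo n f ≈ 0#
  sumTo-zero zero z = refl
  sumTo-zero (suc n) z =
    trans (+-cong (sumTo-zero n (λ i i<n → z i (m<n⇒m<1+n i<n))) (z n ≤-refl)) (+-identityʳ 0#)

  sumTo₂-cong : ∀ n m {f g : ℕ → ℕ → Carrier} → (∀ a b → f a b ≈ g a b) →
    sumTo n (λ a → sumTo m (f a)) ≈ sumTo n (λ a → sumTo m (g a))
  sumTo₂-cong n m eq = sumTo-cong n (λ a → sumTo-cong m (eq a))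

  sumTo₂-cong< : ∀ n m {f g : ℕ → ℕ → Carrier} → (∀ a b → a < n → b < m → f a b ≈ g a b) →
    sumTo n (λ a → sumTo m (f a)) ≈ sumTo n (λ a → sumTo m (g a))
  sumTo₂-cong< n m eq = sumTo-cong< n (λ a a<n → sumTo-cong< m (λ b b<m → eq a b a<n b<m))

  sumTo₂-zero : ∀ n m {f : ℕ → ℕ → Carrier} → (∀ a b → f a b ≈ 0#) → sumTo n (λ a → sumTo m (f a)) ≈ 0#
  sumTo₂-zero n m z = sumTo-zero n (λ a _ → sumTo-zero m (λ b _ → z a b))

  sumTo-+ : ∀ n (f g : ℕ → Carrier) → sumTo n (λ i → f i + g i) ≈ sumTo n f + sumTo n g
  sumTo-+ zero f g = sym (+-identityʳ 0#)
  sumTo-+ (suc n) f g = trans (+-cong (sumTo-+ n f g) refl) (+-interchange _ _ _ _)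

  *-distribˡ-sumTo : ∀ n x (f : ℕ → Carrier) → x * sumTo n f ≈ sumTo n (λ i → x * f i)
  *-distribˡ-sumTo zero x f = zeroʳ x
  *-distribˡ-sumTo (suc n) x f = trans (distribˡ x _ _) (+-cong (*-distribˡ-sumTo n x f) refl)

  *-distribˡ-sumTo₂ : ∀ n m x (f : ℕ → ℕ → Carrier) →
    x * sumTo n (λ a → sumTo m (λ b → f a b)) ≈ sumTo n (λ a → sumTo m (λ b → x * f a b))
  *-distribˡ-sumTo₂ n m x f = trans (*-distribˡ-sumTo n x _) (sumTo-cong n (λ a → *-distribˡ-sumTo m x _))

  *-distribʳ-sumTo : ∀ n x (f : ℕ → Carrier) → sumTo n f * x ≈ sumTo n (λ i → f i * x)
  *-distribʳ-sumTo n x f =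
    trans (*-comm _ x) (trans (*-distribˡ-sumTo n x f) (sumTo-cong n (λ i → *-comm x (f i))))

  sumTo-*-sumTo : ∀ n m (f g : ℕ → Carrier) →
    sumTo n f * sumTo m g ≈ sumTo n (λ a → sumTo m (λ b → f a * g b))
  sumTo-*-sumTo n m f g =
    trans (*-distribʳ-sumTo n _ f) (sumTo-cong n (λ a → *-distribˡ-sumTo m (f a) g))

  sumTo-swap : ∀ n m (f : ℕ → ℕ → Carrier) →
    sumTo n (λ i → sumTo m (λ j → f i j)) ≈ sumTo m (λ j → sumTo n (λ i → f i j))
  sumTo-swap zero m f = sym (sumTo-zero m (λ _ _ → refl))
  sumTo-swap (suc n) m f = trans (+-cong (sumTo-swap n m f) refl) (sym (sumTo-+ m _ _))

  sumTo-swap₃ : ∀ n m l (f : ℕ → ℕ → ℕ → Carrier) →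
    sumTo n (λ i → sumTo m (λ a → sumTo l (λ b → f i a b))) ≈
    sumTo m (λ a → sumTo l (λ b → sumTo n (λ i → f i a b)))
  sumTo-swap₃ n m l f = trans (sumTo-swap n m _) (sumTo-cong m (λ a → sumTo-swap n l _))

  sumTo-swap₄ : ∀ n m l o (f : ℕ → ℕ → ℕ → ℕ → Carrier) →
    sumTo n (λ s → sumTo m (λ t → sumTo l (λ a → sumTo o (λ b → f s t a b)))) ≈
    sumTo l (λ a → sumTo o (λ b → sumTo n (λ s → sumTo m (λ t → f s t a b))))
  sumTo-swap₄ n m l o f =
    trans (sumTo-cong n (λ s → sumTo-swap₃ m l o _)) (sumTo-swap₃ n l o _)

  sumTo-extend : ∀ {n} m (f : ℕ → Carrier) → n ≤ m → (∀ j → n ≤ j → f j ≈ 0#) →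
    sumTo n f ≈ sumTo m f
  sumTo-extend zero f z≤n _ = refl
  sumTo-extend {n} (suc m) f n≤1+m f≈0 with m≤n⇒m<n∨m≡n n≤1+m
  ... | inj₂ ≡.refl = refl
  ... | inj₁ n<1+m = begin
    sumTo n f          ≈⟨ sumTo-extend m f (≤-pred n<1+m) f≈0 ⟩
    sumTo m f          ≈⟨ +-identityʳ _ ⟨
    sumTo m f + 0#     ≈⟨ +-cong refl (f≈0 m (≤-pred n<1+m)) ⟨
    sumTo (suc m) f    ∎

  sumTo-vanishing : ∀ n m (f : ℕ → Carrier) →
    (∀ j → n ≤ j → f j ≈ 0#) → (∀ j → m ≤ j → f j ≈ 0#) → sumTo n f ≈ sumTo m f
  sumTo-vanishing n m f f≈0ₙ f≈0ₘ with ≤-total n m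
  ... | inj₁ n≤m = sumTo-extend m f n≤m f≈0ₙ
  ... | inj₂ m≤n = sym (sumTo-extend n f m≤n f≈0ₘ)

  δ : ℕ → ℕ → Carrier
  δ x y with x ≟ y
  ... | yes _ = 1#
  ... | no _ = 0#

  δ-≡ : ∀ {x y} → x ≡ y → δ x y ≈ 1#
  δ-≡ {x} {y} x≡y with x ≟ y
  ... | yes _ = refl
  ... | no x≢y = ⊥-elim (x≢y x≡y)

  δ-≢ : ∀ {x y} → ¬ x ≡ y → δ x y ≈ 0#
  δ-≢ {x} {y} x≢y with x ≟ y
  ... | yes x≡y = ⊥-elim (x≢y x≡y)
  ... | no _ = refl

  δ-refl : ∀ x → δ x x ≈ 1#
  δ-refl x = δ-≡ {x} ≡.refl

  δ-sym : ∀ x y → δ x y ≈ δ y x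
  δ-sym x y with x ≟ y
  ... | yes x≡y = sym (δ-≡ (≡.sym x≡y))
  ... | no x≢y = sym (δ-≢ (λ y≡x → x≢y (≡.sym y≡x)))

  δ-≢-* : ∀ {x y} z → ¬ x ≡ y → δ x y * z ≈ 0#
  δ-≢-* z x≢y = zeroˡ′ z (δ-≢ x≢y)

  δ-*-subst : ∀ x y (φ : ℕ → Carrier) → δ x y * φ y ≈ δ x y * φ x
  δ-*-subst x y φ with x ≟ y
  ... | yes ≡.refl = refl
  ... | no _ = trans (zeroˡ _) (sym (zeroˡ _))

  sumTo-δ : ∀ R x (φ : ℕ → Carrier) → x < R → sumTo R (λ j → δ x j * φ j) ≈ φ x
  sumTo-δ (suc R) x φ x<1+R with m≤n⇒m<n∨m≡n (≤-pred x<1+R)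
  ... | inj₁ x<R = trans (+-cong (sumTo-δ R x φ x<R) (δ-≢-* (φ R) (<⇒≢ x<R))) (+-identityʳ _)
  ... | inj₂ ≡.refl = begin
    sumTo x (λ j → δ x j * φ j) + δ x x * φ x
      ≈⟨ +-cong (sumTo-zero x (λ j j<x → δ-≢-* (φ j) (λ x≡j → <⇒≢ j<x (≡.sym x≡j)))) refl ⟩
    0# + δ x x * φ x
      ≈⟨ trans (+-identityˡ _) (trans (*-cong (δ-refl x) refl) (*-identityˡ _)) ⟩
    φ x ∎

  sumTo-δ′ : ∀ R x (φ : ℕ → Carrier) → x < R → sumTo R (λ j → δ j x * φ j) ≈ φ x
  sumTo-δ′ R x φ x<R = trans (sumTo-cong R (λ j → *-cong (δ-sym j x) refl)) (sumTo-δ R x φ x<R)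

  sumTo-δ-corner : ∀ R m n (C : ℕ → ℕ → Carrier) → m < R → n < R →
    (∀ s t → m < s ⊎ n < t → C s t ≈ 0#) →
    sumTo R (λ s → sumTo R (λ t → δ (s ℕ.+ t) (m ℕ.+ n) * C s t)) ≈ C m n
  sumTo-δ-corner R m n C m<R n<R C≈0 = begin
    sumTo R (λ s → sumTo R (λ t → δ (s ℕ.+ t) (m ℕ.+ n) * C s t))
      ≈⟨ sumTo₂-cong R R separate ⟩
    sumTo R (λ s → sumTo R (λ t → δ m s * (δ n t * C s t)))
      ≈⟨ sumTo-cong R (λ s → sym (*-distribˡ-sumTo R (δ m s) _)) ⟩
    sumTo R (λ s → δ m s * sumTo R (λ t → δ n t * C s t))
      ≈⟨ sumTo-δ R m _ m<R ⟩
    sumTo R (λ t → δ n t * C m t)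
      ≈⟨ sumTo-δ R n _ n<R ⟩
    C m n ∎
    where
    -- s + t = m + n with C s t ≉ 0 forces s = m and t = n
    separate : ∀ s t → δ (s ℕ.+ t) (m ℕ.+ n) * C s t ≈ δ m s * (δ n t * C s t)
    separate s t with s ≟ m | t ≟ n
    ... | yes ≡.refl | yes ≡.refl = trans (*-cong (δ-refl (s ℕ.+ t)) refl) (trans (*-identityˡ _)
      (sym (trans (*-cong (δ-refl s) (trans (*-cong (δ-refl t) refl) (*-identityˡ _))) (*-identityˡ _))))
    ... | yes ≡.refl | no t≢n = trans (δ-≢-* _ (λ e → t≢n (ℕ.+-cancelˡ-≡ s t n e)))
      (sym (zeroʳ′ _ (δ-≢-* _ (λ n≡t → t≢n (≡.sym n≡t)))))
    ... | no s≢m | _ = trans off-corner (sym (δ-≢-* _ (λ m≡s → s≢m (≡.sym m≡s))))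
      where
      off-corner : δ (s ℕ.+ t) (m ℕ.+ n) * C s t ≈ 0#
      off-corner with (s ℕ.+ t) ≟ (m ℕ.+ n)
      ... | no _ = zeroˡ _
      ... | yes s+t≡m+n with ℕ.<-cmp s m
      ...   | tri≈ _ s≡m _ = ⊥-elim (s≢m s≡m)
      ...   | tri> _ _ m<s = trans (*-identityˡ _) (C≈0 s t (inj₁ m<s))
      ...   | tri< s<m _ _ = trans (*-identityˡ _) (C≈0 s t (inj₂ n<t))
        where
        n<t : n < t
        n<t = ℕ.+-cancelˡ-< s n t (ℕ.<-≤-trans (ℕ.+-monoˡ-< n s<m) (ℕ.≤-reflexive (≡.sym s+t≡m+n)))

  sumTo-antidiagonal : ∀ N i (φ : ℕ → ℕ → Carrier) → (∀ a c → N ≤ a ⊎ N ≤ c → φ a c ≈ 0#) →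
    sumTo (suc i) (λ a → φ a (i ℕ.∸ a)) ≈ sumTo N (λ a → sumTo N (λ c → δ (a ℕ.+ c) i * φ a c))
  sumTo-antidiagonal N i φ φ≈0 =
    trans (sumTo-cong< (suc i) (λ a a<1+i → sym (row-≤ a (≤-pred a<1+i))))
          (sumTo-vanishing (suc i) N row row-> row-≥N)
    where
    row : ℕ → Carrier
    row a = sumTo N (λ c → δ (a ℕ.+ c) i * φ a c)
    δ-+-∸ : ∀ {a} c → a ≤ i → δ (a ℕ.+ c) i ≈ δ (i ℕ.∸ a) c
    δ-+-∸ {a} c a≤i with (a ℕ.+ c) ≟ i
    ... | yes a+c≡i = sym (δ-≡ (≡.trans (≡.cong (ℕ._∸ a) (≡.sym a+c≡i)) (ℕ.m+n∸m≡n a c)))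
    ... | no a+c≢i =
      sym (δ-≢ (λ i∸a≡c → a+c≢i (≡.trans (≡.cong (a ℕ.+_) (≡.sym i∸a≡c)) (ℕ.m+[n∸m]≡n a≤i))))
    row-≤ : ∀ a → a ≤ i → row a ≈ φ a (i ℕ.∸ a)
    row-≤ a a≤i with (i ℕ.∸ a) ℕ.<? N
    ... | yes i∸a<N =
      trans (sumTo-cong N (λ c → *-cong (δ-+-∸ c a≤i) refl)) (sumTo-δ N (i ℕ.∸ a) (φ a) i∸a<N)
    ... | no i∸a≮N = trans
      (sumTo-zero N (λ c c<N → zeroˡ′ _ (trans (δ-+-∸ c a≤i)
        (δ-≢ (λ i∸a≡c → i∸a≮N (≡.subst (ℕ._< N) (≡.sym i∸a≡c) c<N))))))
      (sym (φ≈0 a (i ℕ.∸ a) (inj₂ (ℕ.≮⇒≥ i∸a≮N))))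
    row-> : ∀ a → suc i ≤ a → row a ≈ 0#
    row-> a i<a = sumTo-zero N (λ c _ → δ-≢-* _ (λ a+c≡i →
      ℕ.<-irrefl ≡.refl (ℕ.<-≤-trans i<a (≡.subst (a ℕ.≤_) a+c≡i (ℕ.m≤m+n a c)))))
    row-≥N : ∀ a → N ≤ a → row a ≈ 0#
    row-≥N a N≤a = sumTo-zero N (λ c _ → zeroʳ′ _ (φ≈0 a c (inj₁ N≤a)))

module Characteristic {c ℓ} (K : Field c ℓ) where
  open Field K
  open FieldOps K
  open import Relation.Binary.Reasoning.Setoid setoid

  ι-+ : ∀ a b → ι (a ℕ.+ b) ≈ ι a + ι b
  ι-+ zero b = sym (+-identityˡ _)
  ι-+ (suc a) b = trans (+-cong refl (ι-+ a b)) (sym (+-assoc _ _ _))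

  ι-* : ∀ a b → ι (a ℕ.* b) ≈ ι a * ι b
  ι-* zero b = sym (zeroˡ _)
  ι-* (suc a) b = begin
    ι (b ℕ.+ a ℕ.* b)     ≈⟨ ι-+ b (a ℕ.* b) ⟩
    ι b + ι (a ℕ.* b)     ≈⟨ +-cong (sym (*-identityˡ _)) (ι-* a b) ⟩
    1# * ι b + ι a * ι b  ≈⟨ distribʳ _ _ _ ⟨
    (1# + ι a) * ι b      ∎

  ι-*-zero : ∀ x {n} → ι n ≈ 0# → ι (x ℕ.* n) ≈ 0#
  ι-*-zero x {n} ιn≈0 = trans (ι-* x n) (trans (*-cong refl ιn≈0) (zeroʳ _))

  ι-1+*-one : ∀ x {n} → ι n ≈ 0# → ι (1 ℕ.+ x ℕ.* n) ≈ 1#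
  ι-1+*-one x ιn≈0 = trans (+-cong refl (ι-*-zero x ιn≈0)) (+-identityʳ 1#)

  -- Bézout: 1 + y n = x p (or vice versa) would make 1 ≈ 0
  ι-nonzero : ∀ {p n} → Prime p → ι p ≈ 0# → .{{NonZero n}} → n < p → ¬ ι n ≈ 0#
  ι-nonzero {p} {n} p-prime ιp≈0 n<p ιn≈0 with coprime-Bézout (prime⇒coprime p-prime n<p)
  ... | Bézout.+- x y 1+yn≡xp = 1≉0 (begin
    1#                  ≈⟨ ι-1+*-one y ιn≈0 ⟨
    ι (1 ℕ.+ y ℕ.* n)   ≡⟨ ≡.cong ι 1+yn≡xp ⟩
    ι (x ℕ.* p)         ≈⟨ ι-*-zero x ιp≈0 ⟩
    0#                  ∎)
  ... | Bézout.-+ x y 1+xp≡yn = 1≉0 (begin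
    1#                  ≈⟨ ι-1+*-one x ιp≈0 ⟨
    ι (1 ℕ.+ x ℕ.* p)   ≡⟨ ≡.cong ι 1+xp≡yn ⟩
    ι (y ℕ.* n)         ≈⟨ ι-*-zero y ιn≈0 ⟩
    0#                  ∎)

module FieldProperties {c ℓ} (K : Field c ℓ) where
  open Field K
  open import Relation.Binary.Reasoning.Setoid setoid

  *-nonzero : ∀ {x y} → ¬ x ≈ 0# → ¬ y ≈ 0# → ¬ x * y ≈ 0#
  *-nonzero {x} {y} x≉0 y≉0 xy≈0 with inverse x x≉0
  ... | x⁻¹ , xx⁻¹≈1 = y≉0 (begin
    y                ≈⟨ *-identityˡ y ⟨
    1# * y           ≈⟨ *-cong xx⁻¹≈1 refl ⟨
    (x * x⁻¹) * y    ≈⟨ *-cong (*-comm x x⁻¹) refl ⟩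
    (x⁻¹ * x) * y    ≈⟨ *-assoc x⁻¹ x y ⟩
    x⁻¹ * (x * y)    ≈⟨ *-cong refl xy≈0 ⟩
    x⁻¹ * 0#         ≈⟨ zeroʳ x⁻¹ ⟩
    0#               ∎)

module Convolution {c ℓ} (K : Field c ℓ) where
  open Field K
  open FieldOps K
  open FiniteSums K
  open Characteristic K using (ι-+)
  open FieldProperties K using (*-nonzero)
  open import Relation.Binary.Reasoning.Setoid setoid
  open import Algebra.Properties.CommutativeSemigroup *-commutativeSemigroup
    using () renaming (x∙yz≈y∙xz to x*yz≈y*xz; x∙yz≈z∙xy to x*yz≈z*xy; x∙yz≈y∙zx to x*yz≈y*zx)
  open import Algebra.Properties.CommutativeSemigroup ℕ.+-commutativeSemigroup
    using () renaming (interchange to +-interchangeℕ)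

  -- Coefficient sequences are multiplied through a Kronecker delta, so that every sum runs
  -- over a fixed range R (resp. S) in which the factors are supported.
  conv : ℕ → (ℕ → Carrier) → (ℕ → Carrier) → ℕ → Carrier
  conv R u v k = sumTo R (λ a → sumTo R (λ c → δ (a ℕ.+ c) k * (u a * v c)))

  shift : ℕ → ℕ → (ℕ → Carrier) → ℕ → Carrier
  shift R x u k = sumTo R (λ b → δ (x ℕ.+ b) k * u b)

  conv₂ : ℕ → ℕ → (ℕ → ℕ → Carrier) → (ℕ → ℕ → Carrier) → ℕ → ℕ → Carrier
  conv₂ R S A B k i = sumTo R (λ s → sumTo R (λ t → δ (s ℕ.+ t) k * conv S (A s) (B t) i))

  sumTo-*-conv : ∀ R (w u v : ℕ → Carrier) →
    sumTo (R ℕ.+ R) (λ i → w i * conv R u v i) ≈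
    sumTo R (λ a → sumTo R (λ c → w (a ℕ.+ c) * (u a * v c)))
  sumTo-*-conv R w u v = begin
    sumTo (R ℕ.+ R) (λ i → w i * sumTo R (λ a → sumTo R (λ c → δ (a ℕ.+ c) i * (u a * v c))))
      ≈⟨ sumTo-cong (R ℕ.+ R) (λ i →
           trans (*-distribˡ-sumTo₂ R R (w i) _) (sumTo₂-cong R R (λ a c → x*yz≈y*xz _ _ _))) ⟩
    sumTo (R ℕ.+ R) (λ i → sumTo R (λ a → sumTo R (λ c → δ (a ℕ.+ c) i * (w i * (u a * v c)))))
      ≈⟨ sumTo-swap₃ (R ℕ.+ R) R R _ ⟩
    sumTo R (λ a → sumTo R (λ c → sumTo (R ℕ.+ R) (λ i → δ (a ℕ.+ c) i * (w i * (u a * v c)))))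
      ≈⟨ sumTo₂-cong< R R (λ a c a<R c<R → sumTo-δ (R ℕ.+ R) (a ℕ.+ c) _ (ℕ.+-mono-< a<R c<R)) ⟩
    sumTo R (λ a → sumTo R (λ c → w (a ℕ.+ c) * (u a * v c))) ∎

  sumTo-conv : ∀ R u v → sumTo (R ℕ.+ R) (conv R u v) ≈ sumTo R u * sumTo R v
  sumTo-conv R u v = begin
    sumTo (R ℕ.+ R) (conv R u v)
      ≈⟨ sumTo-cong (R ℕ.+ R) (λ i → *-identityˡ _) ⟨
    sumTo (R ℕ.+ R) (λ i → 1# * conv R u v i)
      ≈⟨ sumTo-*-conv R (λ _ → 1#) u v ⟩
    sumTo R (λ a → sumTo R (λ c → 1# * (u a * v c)))
      ≈⟨ trans (sumTo₂-cong R R (λ a c → *-identityˡ _)) (sym (sumTo-*-sumTo R R u v)) ⟩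
    sumTo R u * sumTo R v ∎

  -- Leibniz rule for t d/dt, read off at t = 1
  sumTo-ι-conv : ∀ R u v → sumTo (R ℕ.+ R) (λ i → ι i * conv R u v i) ≈
    sumTo R (λ a → ι a * u a) * sumTo R v + sumTo R u * sumTo R (λ c → ι c * v c)
  sumTo-ι-conv R u v = begin
    sumTo (R ℕ.+ R) (λ i → ι i * conv R u v i)
      ≈⟨ sumTo-*-conv R ι u v ⟩
    sumTo R (λ a → sumTo R (λ c → ι (a ℕ.+ c) * (u a * v c)))
      ≈⟨ sumTo₂-cong R R leibniz ⟩
    sumTo R (λ a → sumTo R (λ c → (ι a * u a) * v c + u a * (ι c * v c)))
      ≈⟨ trans (sumTo-cong R (λ a → sumTo-+ R _ _)) (sumTo-+ R _ _) ⟩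
    sumTo R (λ a → sumTo R (λ c → (ι a * u a) * v c)) + sumTo R (λ a → sumTo R (λ c → u a * (ι c * v c)))
      ≈⟨ +-cong (sumTo-*-sumTo R R _ _) (sumTo-*-sumTo R R _ _) ⟨
    sumTo R (λ a → ι a * u a) * sumTo R v + sumTo R u * sumTo R (λ c → ι c * v c) ∎
    where
    leibniz : ∀ a c → ι (a ℕ.+ c) * (u a * v c) ≈ (ι a * u a) * v c + u a * (ι c * v c)
    leibniz a c = trans (*-cong (ι-+ a c) refl)
      (trans (distribʳ _ _ _) (+-cong (sym (*-assoc _ _ _)) (x*yz≈y*xz _ _ _)))

  conv-corner : ∀ R m n (u v : ℕ → Carrier) → m < R → n < R →
    (∀ k → m < k → u k ≈ 0#) → (∀ k → n < k → v k ≈ 0#) → conv R u v (m ℕ.+ n) ≈ u m * v n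
  conv-corner R m n u v m<R n<R u≈0 v≈0 = sumTo-δ-corner R m n (λ a c → u a * v c) m<R n<R off-corner
    where
    off-corner : ∀ a c → m < a ⊎ n < c → u a * v c ≈ 0#
    off-corner a c (inj₁ m<a) = zeroˡ′ _ (u≈0 a m<a)
    off-corner a c (inj₂ n<c) = zeroʳ′ _ (v≈0 c n<c)

  sumTo-shift : ∀ R x (u φ : ℕ → Carrier) → x < R →
    sumTo (R ℕ.+ R) (λ s → shift R x u s * φ s) ≈ sumTo R (λ b → u b * φ (x ℕ.+ b))
  sumTo-shift R x u φ x<R = begin
    sumTo (R ℕ.+ R) (λ s → shift R x u s * φ s)
      ≈⟨ sumTo-cong (R ℕ.+ R) (λ s → trans (*-distribʳ-sumTo R (φ s) _) (sumTo-cong R (λ b → *-assoc _ _ _))) ⟩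
    sumTo (R ℕ.+ R) (λ s → sumTo R (λ b → δ (x ℕ.+ b) s * (u b * φ s)))
      ≈⟨ sumTo-swap (R ℕ.+ R) R _ ⟩
    sumTo R (λ b → sumTo (R ℕ.+ R) (λ s → δ (x ℕ.+ b) s * (u b * φ s)))
      ≈⟨ sumTo-cong< R (λ b b<R → sumTo-δ (R ℕ.+ R) (x ℕ.+ b) (λ s → u b * φ s) (ℕ.+-mono-< x<R b<R)) ⟩
    sumTo R (λ b → u b * φ (x ℕ.+ b)) ∎

  -- t^(x+y) (u v) = (t^x u) (t^y v)
  shift-conv : ∀ R x y (u v : ℕ → Carrier) k → x < R → y < R →
    shift (R ℕ.+ R) (x ℕ.+ y) (conv R u v) k ≈ conv (R ℕ.+ R) (shift R x u) (shift R y v) k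
  shift-conv R x y u v k x<R y<R = begin
    shift (R ℕ.+ R) (x ℕ.+ y) (conv R u v) k
      ≈⟨ sumTo-*-conv R (λ j → δ ((x ℕ.+ y) ℕ.+ j) k) u v ⟩
    sumTo R (λ b → sumTo R (λ e → δ ((x ℕ.+ y) ℕ.+ (b ℕ.+ e)) k * (u b * v e)))
      ≈⟨ sumTo-cong R (λ b → trans (sumTo-cong R (λ e → regroup b e)) (sym (*-distribˡ-sumTo R (u b) _))) ⟩
    sumTo R (λ b → u b * sumTo R (λ e → v e * δ ((x ℕ.+ b) ℕ.+ (y ℕ.+ e)) k))
      ≈⟨ sumTo-shift R x u _ x<R ⟨
    sumTo (R ℕ.+ R) (λ s → shift R x u s * sumTo R (λ e → v e * δ (s ℕ.+ (y ℕ.+ e)) k))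
      ≈⟨ sumTo-cong (R ℕ.+ R) (λ s → *-cong refl (sumTo-shift R y v (λ t → δ (s ℕ.+ t) k) y<R)) ⟨
    sumTo (R ℕ.+ R) (λ s → shift R x u s * sumTo (R ℕ.+ R) (λ t → shift R y v t * δ (s ℕ.+ t) k))
      ≈⟨ sumTo-cong (R ℕ.+ R) (λ s →
           trans (*-distribˡ-sumTo (R ℕ.+ R) _ _) (sumTo-cong (R ℕ.+ R) (λ t → x*yz≈z*xy _ _ _))) ⟩
    conv (R ℕ.+ R) (shift R x u) (shift R y v) k ∎
    where
    regroup : ∀ b e → δ ((x ℕ.+ y) ℕ.+ (b ℕ.+ e)) k * (u b * v e) ≈
                      u b * (v e * δ ((x ℕ.+ b) ℕ.+ (y ℕ.+ e)) k)
    regroup b e = trans (*-cong (reflexive (≡.cong (λ n → δ n k) (+-interchangeℕ x y b e))) refl)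
      (x*yz≈y*zx _ _ _)

  conv₂-transpose : ∀ R S (A B : ℕ → ℕ → Carrier) k i →
    sumTo S (λ a → sumTo S (λ c → δ (a ℕ.+ c) i * conv R (λ s → A s a) (λ t → B t c) k)) ≈
    conv₂ R S A B k i
  conv₂-transpose R S A B k i = begin
    sumTo S (λ a → sumTo S (λ c → δ (a ℕ.+ c) i * conv R (λ s → A s a) (λ t → B t c) k))
      ≈⟨ sumTo₂-cong S S (λ a c → *-distribˡ-sumTo₂ R R _ _) ⟩
    sumTo S (λ a → sumTo S (λ c → sumTo R (λ s → sumTo R (λ t →
      δ (a ℕ.+ c) i * (δ (s ℕ.+ t) k * (A s a * B t c))))))
      ≈⟨ sumTo-swap₄ S S R R _ ⟩
    sumTo R (λ s → sumTo R (λ t → sumTo S (λ a → sumTo S (λ c →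
      δ (a ℕ.+ c) i * (δ (s ℕ.+ t) k * (A s a * B t c))))))
      ≈⟨ sumTo₂-cong R R (λ s t → sumTo₂-cong S S (λ a c → x*yz≈y*xz _ _ _)) ⟩
    sumTo R (λ s → sumTo R (λ t → sumTo S (λ a → sumTo S (λ c →
      δ (s ℕ.+ t) k * (δ (a ℕ.+ c) i * (A s a * B t c))))))
      ≈⟨ sumTo₂-cong R R (λ s t → *-distribˡ-sumTo₂ S S _ _) ⟨
    conv₂ R S A B k i ∎

  sumTo-*-conv₂ : ∀ R S (w : ℕ → Carrier) (A B : ℕ → ℕ → Carrier) k →
    sumTo (S ℕ.+ S) (λ i → w i * conv₂ R S A B k i) ≈
    sumTo R (λ s → sumTo R (λ t → δ (s ℕ.+ t) k * sumTo (S ℕ.+ S) (λ i → w i * conv S (A s) (B t) i)))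
  sumTo-*-conv₂ R S w A B k = begin
    sumTo (S ℕ.+ S) (λ i → w i * conv₂ R S A B k i)
      ≈⟨ sumTo-cong (S ℕ.+ S) (λ i →
           trans (*-distribˡ-sumTo₂ R R _ _) (sumTo₂-cong R R (λ s t → x*yz≈y*xz _ _ _))) ⟩
    sumTo (S ℕ.+ S) (λ i → sumTo R (λ s → sumTo R (λ t → δ (s ℕ.+ t) k * (w i * conv S (A s) (B t) i))))
      ≈⟨ sumTo-swap₃ (S ℕ.+ S) R R _ ⟩
    sumTo R (λ s → sumTo R (λ t → sumTo (S ℕ.+ S) (λ i → δ (s ℕ.+ t) k * (w i * conv S (A s) (B t) i))))
      ≈⟨ sumTo₂-cong R R (λ s t → *-distribˡ-sumTo (S ℕ.+ S) _ _) ⟨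
    sumTo R (λ s → sumTo R (λ t → δ (s ℕ.+ t) k * sumTo (S ℕ.+ S) (λ i → w i * conv S (A s) (B t) i))) ∎

  sumTo-conv₂ : ∀ R S (A B : ℕ → ℕ → Carrier) k →
    sumTo (S ℕ.+ S) (conv₂ R S A B k) ≈ conv R (λ s → sumTo S (A s)) (λ t → sumTo S (B t)) k
  sumTo-conv₂ R S A B k = begin
    sumTo (S ℕ.+ S) (conv₂ R S A B k)
      ≈⟨ sumTo-cong (S ℕ.+ S) (λ i → *-identityˡ _) ⟨
    sumTo (S ℕ.+ S) (λ i → 1# * conv₂ R S A B k i)
      ≈⟨ sumTo-*-conv₂ R S (λ _ → 1#) A B k ⟩
    sumTo R (λ s → sumTo R (λ t → δ (s ℕ.+ t) k * sumTo (S ℕ.+ S) (λ i → 1# * conv S (A s) (B t) i)))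
      ≈⟨ sumTo₂-cong R R (λ s t → *-cong refl
           (trans (sumTo-cong (S ℕ.+ S) (λ i → *-identityˡ _)) (sumTo-conv S (A s) (B t)))) ⟩
    conv R (λ s → sumTo S (A s)) (λ t → sumTo S (B t)) k ∎

  sumTo-ι-conv₂ : ∀ R S (A B : ℕ → ℕ → Carrier) k →
    sumTo (S ℕ.+ S) (λ i → ι i * conv₂ R S A B k i) ≈
    conv R (λ s → sumTo S (λ a → ι a * A s a)) (λ t → sumTo S (B t)) k +
    conv R (λ s → sumTo S (A s)) (λ t → sumTo S (λ c → ι c * B t c)) k
  sumTo-ι-conv₂ R S A B k = begin
    sumTo (S ℕ.+ S) (λ i → ι i * conv₂ R S A B k i)
      ≈⟨ sumTo-*-conv₂ R S ι A B k ⟩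
    sumTo R (λ s → sumTo R (λ t → δ (s ℕ.+ t) k * sumTo (S ℕ.+ S) (λ i → ι i * conv S (A s) (B t) i)))
      ≈⟨ sumTo₂-cong R R (λ s t → trans (*-cong refl (sumTo-ι-conv S (A s) (B t))) (distribˡ _ _ _)) ⟩
    sumTo R (λ s → sumTo R (λ t →
      δ (s ℕ.+ t) k * (sumTo S (λ a → ι a * A s a) * sumTo S (B t)) +
      δ (s ℕ.+ t) k * (sumTo S (A s) * sumTo S (λ c → ι c * B t c))))
      ≈⟨ trans (sumTo-cong R (λ s → sumTo-+ R _ _)) (sumTo-+ R _ _) ⟩
    conv R (λ s → sumTo S (λ a → ι a * A s a)) (λ t → sumTo S (B t)) k +
    conv R (λ s → sumTo S (A s)) (λ t → sumTo S (λ c → ι c * B t c)) k ∎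

  conv₂-corner : ∀ R S m n i j (A B : ℕ → ℕ → Carrier) → m < R → n < R → i < S → j < S →
    (∀ s → m < s → ∀ a → A s a ≈ 0#) → (∀ a → i < a → A m a ≈ 0#) →
    (∀ t → n < t → ∀ c → B t c ≈ 0#) → (∀ c → j < c → B n c ≈ 0#) →
    conv₂ R S A B (m ℕ.+ n) (i ℕ.+ j) ≈ A m i * B n j
  conv₂-corner R S m n i j A B m<R n<R i<S j<S A>m A>i B>n B>j =
    trans (sumTo-δ-corner R m n (λ s t → conv S (A s) (B t) (i ℕ.+ j)) m<R n<R off-corner)
          (conv-corner S i j (A m) (B n) i<S j<S A>i B>j)
    where
    off-corner : ∀ s t → m < s ⊎ n < t → conv S (A s) (B t) (i ℕ.+ j) ≈ 0#
    off-corner s t (inj₁ m<s) = sumTo₂-zero S S (λ a c → zeroʳ′ _ (zeroˡ′ _ (A>m s m<s a)))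
    off-corner s t (inj₂ n<t) = sumTo₂-zero S S (λ a c → zeroʳ′ _ (zeroʳ′ _ (B>n t n<t c)))

  conv-constant⇒constant : ∀ R (u v : ℕ → Carrier) →
    (∀ k → R ≤ k → u k ≈ 0#) → (∀ k → R ≤ k → v k ≈ 0#) →
    (∀ k → 1 ≤ k → conv R u v k ≈ 0#) → ¬ conv R u v 0 ≈ 0# →
    ¬ ¬ ((∀ k → 1 ≤ k → u k ≈ 0#) × (∀ k → 1 ≤ k → v k ≈ 0#))
  conv-constant⇒constant R u v u≥R v≥R uv>0≈0 uv0≉0 ¬goal =
    ¬¬-all-or-lastFailure (λ k → u k ≈ 0#) R u≥R λ where
      (inj₁ u≈0) → uv0≉0 (sumTo₂-zero R R (λ a c → zeroʳ′ _ (zeroˡ′ _ (u≈0 a))))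
      (inj₂ (m , um≉0 , u>m)) → ¬¬-all-or-lastFailure (λ k → v k ≈ 0#) R v≥R λ where
        (inj₁ v≈0) → uv0≉0 (sumTo₂-zero R R (λ a c → zeroʳ′ _ (zeroʳ′ _ (v≈0 c))))
        (inj₂ (n , vn≉0 , v>n)) → degrees-zero m n um≉0 vn≉0 u>m v>n
          (*-nonzero um≉0 vn≉0 ∘ trans (sym (conv-corner R m n u v
            (<-by-contraposition (u≥R m) um≉0) (<-by-contraposition (v≥R n) vn≉0) u>m v>n)))
    where
    degrees-zero : ∀ m n → ¬ u m ≈ 0# → ¬ v n ≈ 0# →
      (∀ k → m < k → u k ≈ 0#) → (∀ k → n < k → v k ≈ 0#) →
      ¬ conv R u v (m ℕ.+ n) ≈ 0# → ⊥
    degrees-zero zero zero _ _ u>0 v>0 _ = ¬goal (u>0 , v>0)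
    degrees-zero (suc m) n _ _ _ _ uv≉0 = uv≉0 (uv>0≈0 _ (s≤s z≤n))
    degrees-zero zero (suc n) _ _ _ _ uv≉0 = uv≉0 (uv>0≈0 _ (s≤s z≤n))

module HomogeneousComponents {c ℓ} (K : Field c ℓ) (N : ℕ) where
  open Field K
  open FieldOps K
  open FiniteSums K
  open Convolution K
  open FieldProperties K using (*-nonzero)
  open import Relation.Binary.Reasoning.Setoid setoid
  open import Algebra.Properties.CommutativeSemigroup *-commutativeSemigroup
    using () renaming (x∙yz≈y∙xz to x*yz≈y*xz)

  M : ℕ
  M = N ℕ.+ N

  Supported : (ℕ → ℕ → Carrier) → Set ℓ
  Supported P = ∀ a b → N ≤ a ⊎ N ≤ b → P a b ≈ 0#

  coeff-supported : ∀ G → bound G < N → Supported (coeff G)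
  coeff-supported G bound<N x y out with x ℕ.<? suc (bound G) | y ℕ.<? suc (bound G)
  ... | yes x≤bound | yes y≤bound = ⊥-elim ([ N≰ x≤bound , N≰ y≤bound ] out)
    where
    N≰ : ∀ {z} → z < suc (bound G) → ¬ N ≤ z
    N≰ z≤bound N≤z = ℕ.<-irrefl ≡.refl (ℕ.<-≤-trans bound<N (ℕ.≤-trans N≤z (≤-pred z≤bound)))
  ... | yes _ | no _ = refl
  ... | no _ | _ = refl

  mulCoeff-conv₂ : ∀ G H → Supported (coeff G) → Supported (coeff H) →
    ∀ i j → mulCoeff G H i j ≈ conv₂ N N (coeff G) (coeff H) i j
  mulCoeff-conv₂ G H G≈0 H≈0 i j =
    trans (sumTo-antidiagonal N i φ φ≈0)
          (sumTo₂-cong N N (λ a c → *-cong refl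
            (sumTo-antidiagonal N j (λ b e → coeff G a b * coeff H c e) (ψ≈0 a c))))
    where
    φ : ℕ → ℕ → Carrier
    φ a c = sumTo (suc j) (λ b → coeff G a b * coeff H c (j ℕ.∸ b))
    φ≈0 : ∀ a c → N ≤ a ⊎ N ≤ c → φ a c ≈ 0#
    φ≈0 a c (inj₁ N≤a) = sumTo-zero (suc j) (λ b _ → zeroˡ′ _ (G≈0 a b (inj₁ N≤a)))
    φ≈0 a c (inj₂ N≤c) = sumTo-zero (suc j) (λ b _ → zeroʳ′ _ (H≈0 c (j ℕ.∸ b) (inj₁ N≤c)))
    ψ≈0 : ∀ a c b e → N ≤ b ⊎ N ≤ e → coeff G a b * coeff H c e ≈ 0#
    ψ≈0 a c b e (inj₁ N≤b) = zeroˡ′ _ (G≈0 a b (inj₂ N≤b))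
    ψ≈0 a c b e (inj₂ N≤e) = zeroʳ′ _ (H≈0 c e (inj₂ N≤e))

  -- coefficient of x^i y^(k ∸ i) in the degree-k homogeneous component of P
  homog : (ℕ → ℕ → Carrier) → ℕ → ℕ → Carrier
  homog P k i = shift N i (P i) k

  -- coefficients of t^k in P(t,t) and in t (∂P/∂x)(t,t)
  diag : (ℕ → ℕ → Carrier) → ℕ → Carrier
  diag P k = sumTo N (homog P k)

  diagDx : (ℕ → ℕ → Carrier) → ℕ → Carrier
  diagDx P k = sumTo N (λ i → ι i * homog P k i)

  homog-≥ : ∀ P → Supported P → ∀ k i → N ≤ i → homog P k i ≈ 0#
  homog-≥ P P≈0 k i N≤i = sumTo-zero N (λ j _ → zeroʳ′ _ (P≈0 i j (inj₁ N≤i)))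

  homog-≥M : ∀ P → Supported P → ∀ k i → M ≤ k → homog P k i ≈ 0#
  homog-≥M P P≈0 k i M≤k with i ℕ.<? N
  ... | no i≮N = homog-≥ P P≈0 k i (ℕ.≮⇒≥ i≮N)
  ... | yes i<N = sumTo-zero N (λ j j<N → δ-≢-* _ (λ i+j≡k →
        ℕ.<-irrefl i+j≡k (ℕ.<-≤-trans (ℕ.+-mono-< i<N j<N) M≤k)))

  homog-coeff : ∀ P i j → j < N → homog P (i ℕ.+ j) i ≈ P i j
  homog-coeff P i j j<N = trans (sumTo-cong N (λ b → *-cong (δ-+-cancelˡ b) refl)) (sumTo-δ′ N j (P i) j<N)
    where
    δ-+-cancelˡ : ∀ b → δ (i ℕ.+ b) (i ℕ.+ j) ≈ δ b j
    δ-+-cancelˡ b = by-cases (b ≟ j)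
      where
      by-cases : Dec (b ≡ j) → δ (i ℕ.+ b) (i ℕ.+ j) ≈ δ b j
      by-cases (yes b≡j) = trans (δ-≡ (≡.cong (i ℕ.+_) b≡j)) (sym (δ-≡ b≡j))
      by-cases (no b≢j) = trans (δ-≢ (λ e → b≢j (ℕ.+-cancelˡ-≡ i b j e))) (sym (δ-≢ b≢j))

  diag-zero : ∀ P → 0 < N → diag P 0 ≈ P 0 0
  diag-zero P 0<N = trans (sumTo-cong N column) (sumTo-δ′ N 0 (λ _ → P 0 0) 0<N)
    where
    column : ∀ i → homog P 0 i ≈ δ i 0 * P 0 0
    column zero = trans (homog-coeff P 0 0 0<N) (sym (*-identityˡ _))
    column (suc i) = trans (sumTo-zero N (λ j _ → zeroˡ _)) (sym (zeroˡ _))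

  homog-conv₂ : ∀ f g h → Supported f → (∀ i j → f i j ≈ conv₂ N N g h i j) →
    ∀ k i → homog f k i ≈ conv₂ M N (homog g) (homog h) k i
  homog-conv₂ f g h f≈0 f≈gh k i = begin
    sumTo N (λ j → δ (i ℕ.+ j) k * f i j)
      ≈⟨ sumTo-extend M _ (ℕ.m≤m+n N N) (λ j N≤j → zeroʳ′ _ (f≈0 i j (inj₂ N≤j))) ⟩
    sumTo M (λ j → δ (i ℕ.+ j) k * f i j)
      ≈⟨ sumTo-cong M (λ j → trans (*-cong refl (f≈gh i j)) (*-distribˡ-sumTo₂ N N _ _)) ⟩
    sumTo M (λ j → sumTo N (λ a → sumTo N (λ c → δ (i ℕ.+ j) k * (δ (a ℕ.+ c) i * conv N (g a) (h c) j))))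
      ≈⟨ sumTo-swap₃ M N N _ ⟩
    sumTo N (λ a → sumTo N (λ c → sumTo M (λ j → δ (i ℕ.+ j) k * (δ (a ℕ.+ c) i * conv N (g a) (h c) j))))
      ≈⟨ sumTo-cong N (λ a → sumTo-cong N (λ c →
           trans (sumTo-cong M (λ j → x*yz≈y*xz _ _ _)) (sym (*-distribˡ-sumTo M _ _)))) ⟩
    sumTo N (λ a → sumTo N (λ c → δ (a ℕ.+ c) i * shift M i (conv N (g a) (h c)) k))
      ≈⟨ sumTo-cong N (λ a → sumTo-cong N (λ c →
           δ-*-subst (a ℕ.+ c) i (λ x → shift M x (conv N (g a) (h c)) k))) ⟩
    sumTo N (λ a → sumTo N (λ c → δ (a ℕ.+ c) i * shift M (a ℕ.+ c) (conv N (g a) (h c)) k))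
      ≈⟨ sumTo-cong< N (λ a a<N → sumTo-cong< N (λ c c<N →
           *-cong refl (shift-conv N a c (g a) (h c) k a<N c<N))) ⟩
    sumTo N (λ a → sumTo N (λ c → δ (a ℕ.+ c) i * conv M (λ s → homog g s a) (λ t → homog h t c) k))
      ≈⟨ conv₂-transpose M N (homog g) (homog h) k i ⟩
    conv₂ M N (homog g) (homog h) k i ∎

  diag-conv : ∀ f g h → Supported f → (∀ i j → f i j ≈ conv₂ N N g h i j) →
    ∀ k → diag f k ≈ conv M (diag g) (diag h) k
  diag-conv f g h f≈0 f≈gh k = begin
    sumTo N (homog f k)                        ≈⟨ sumTo-extend M _ (ℕ.m≤m+n N N) (homog-≥ f f≈0 k) ⟩
    sumTo M (homog f k)                        ≈⟨ sumTo-cong M (homog-conv₂ f g h f≈0 f≈gh k) ⟩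
    sumTo M (conv₂ M N (homog g) (homog h) k)  ≈⟨ sumTo-conv₂ M N (homog g) (homog h) k ⟩
    conv M (diag g) (diag h) k                 ∎

  diagDx-conv : ∀ f g h → Supported f → (∀ i j → f i j ≈ conv₂ N N g h i j) →
    ∀ k → diagDx f k ≈ conv M (diagDx g) (diag h) k + conv M (diag g) (diagDx h) k
  diagDx-conv f g h f≈0 f≈gh k = begin
    sumTo N (λ i → ι i * homog f k i)
      ≈⟨ sumTo-extend M _ (ℕ.m≤m+n N N) (λ i N≤i → zeroʳ′ _ (homog-≥ f f≈0 k i N≤i)) ⟩
    sumTo M (λ i → ι i * homog f k i)
      ≈⟨ sumTo-cong M (λ i → *-cong refl (homog-conv₂ f g h f≈0 f≈gh k i)) ⟩
    sumTo M (λ i → ι i * conv₂ M N (homog g) (homog h) k i)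
      ≈⟨ sumTo-ι-conv₂ M N (homog g) (homog h) k ⟩
    conv M (diagDx g) (diag h) k + conv M (diag g) (diagDx h) k ∎

  NonconstantTable : (ℕ → ℕ → Carrier) → Set ℓ
  NonconstantTable P = ∃ λ i → ∃ λ j → ¬ (i ≡ 0 × j ≡ 0) × ¬ (P i j ≈ 0#)

  HasLeadingTerm : (ℕ → ℕ → Carrier) → ℕ → ℕ → Set ℓ
  HasLeadingTerm A m i = (∀ s → m < s → ∀ a → A s a ≈ 0#) × ¬ A m i ≈ 0# × (∀ a → i < a → A m a ≈ 0#)

  ¬¬-leadingTerm : ∀ P → Supported P → NonconstantTable P →
    ¬ ¬ (∃ λ m → ∃ λ i → 1 ≤ m × m < M × i < N × HasLeadingTerm (homog P) m i)
  ¬¬-leadingTerm P P≈0 (i₀ , j₀ , ij≢00 , Pij≉0) ¬goal =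
    ¬¬-all-or-lastFailure (λ k → ∀ a → homog P k a ≈ 0#) M (λ k M≤k a → homog-≥M P P≈0 k a M≤k)
    λ where
      (inj₁ homog≈0) → Pij≉0 (trans (sym (homog-coeff P i₀ j₀ j₀<N)) (homog≈0 _ i₀))
      (inj₂ (m , ¬row≈0 , homog>m)) →
        ¬¬-all-or-lastFailure (λ a → homog P m a ≈ 0#) N (homog-≥ P P≈0 m) λ where
          (inj₁ row≈0) → ¬row≈0 row≈0
          (inj₂ (i , Pmi≉0 , row>i)) →
            ¬goal (m , i , 1≤m homog>m , m<M ¬row≈0 , i<N Pmi≉0 , homog>m , Pmi≉0 , row>i)
    where
    j₀<N : j₀ < N
    j₀<N = <-by-contraposition (λ N≤j₀ → P≈0 i₀ j₀ (inj₂ N≤j₀)) Pij≉0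
    1≤+ : ∀ a b → ¬ (a ≡ 0 × b ≡ 0) → 1 ≤ a ℕ.+ b
    1≤+ zero zero ≢00 = ⊥-elim (≢00 (≡.refl , ≡.refl))
    1≤+ (suc _) _ _ = s≤s z≤n
    1≤+ zero (suc _) _ = s≤s z≤n
    1≤m : ∀ {m} → (∀ s → m < s → ∀ a → homog P s a ≈ 0#) → 1 ≤ m
    1≤m {m} homog>m with m ℕ.<? i₀ ℕ.+ j₀
    ... | yes m<i₀+j₀ = ⊥-elim (Pij≉0 (trans (sym (homog-coeff P i₀ j₀ j₀<N)) (homog>m _ m<i₀+j₀ i₀)))
    ... | no m≮i₀+j₀ = ℕ.≤-trans (1≤+ i₀ j₀ ij≢00) (ℕ.≮⇒≥ m≮i₀+j₀)
    m<M : ∀ {m} → ¬ (∀ a → homog P m a ≈ 0#) → m < M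
    m<M {m} ¬row≈0 = <-by-contraposition (λ M≤m a → homog-≥M P P≈0 m a M≤m) ¬row≈0
    i<N : ∀ {m i} → ¬ homog P m i ≈ 0# → i < N
    i<N {m} {i} = <-by-contraposition (homog-≥ P P≈0 m i)

  no-nonconstant-factors : ∀ f g h → Supported f → Supported g → Supported h →
    (∀ i j → f i j ≈ conv₂ N N g h i j) →
    (∀ k → 1 ≤ k → diag f k ≈ 0#) → ¬ diag f 0 ≈ 0# →
    (∀ k i → 1 ≤ k → ¬ homog f k i ≈ 0# → ¬ diagDx f k ≈ 0#) →
    ¬ (NonconstantTable g × NonconstantTable h)
  no-nonconstant-factors f g h f≈0 g≈0 h≈0 f≈gh diag-f≈0 diag-f0≉0 dx≉0 (g-nc , h-nc) =
    conv-constant⇒constant M (diag g) (diag h) (diag-≥M g g≈0) (diag-≥M h h≈0)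
      (λ k 1≤k → trans (sym (diag-conv f g h f≈0 f≈gh k)) (diag-f≈0 k 1≤k))
      (diag-f0≉0 ∘ trans (diag-conv f g h f≈0 f≈gh 0)) λ (g-const , h-const) →
    ¬¬-leadingTerm g g≈0 g-nc λ (m , i , 1≤m , m<M , i<N , g>m , gmi≉0 , gm>i) →
    ¬¬-leadingTerm h h≈0 h-nc λ (n , j , 1≤n , n<M , j<N , h>n , hnj≉0 , hn>j) →
    let leading-f : homog f (m ℕ.+ n) (i ℕ.+ j) ≈ homog g m i * homog h n j
        leading-f = trans (homog-conv₂ f g h f≈0 f≈gh _ _)
          (conv₂-corner M N m n i j (homog g) (homog h) m<M n<M i<N j<N g>m gm>i h>n hn>j)
        dx-leading-f : diagDx f (m ℕ.+ n) ≈ 0#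
        dx-leading-f = begin
          diagDx f (m ℕ.+ n)
            ≈⟨ diagDx-conv f g h f≈0 f≈gh _ ⟩
          conv M (diagDx g) (diag h) (m ℕ.+ n) + conv M (diag g) (diagDx h) (m ℕ.+ n)
            ≈⟨ +-cong (conv-corner M m n _ _ m<M n<M (diagDx-above g>m) (diag-above h>n))
                      (conv-corner M m n _ _ m<M n<M (diag-above g>m) (diagDx-above h>n)) ⟩
          diagDx g m * diag h n + diag g m * diagDx h n
            ≈⟨ +-≈0 (zeroʳ′ _ (h-const n 1≤n)) (zeroˡ′ _ (g-const m 1≤m)) ⟩
          0# ∎
    in dx≉0 (m ℕ.+ n) (i ℕ.+ j) (ℕ.≤-trans 1≤m (ℕ.m≤m+n m n))
         (*-nonzero gmi≉0 hnj≉0 ∘ trans (sym leading-f)) dx-leading-f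
    where
    diag-≥M : ∀ P → Supported P → ∀ k → M ≤ k → diag P k ≈ 0#
    diag-≥M P P≈0 k M≤k = sumTo-zero N (λ i _ → homog-≥M P P≈0 k i M≤k)
    diag-above : ∀ {P m} → (∀ s → m < s → ∀ a → homog P s a ≈ 0#) → ∀ s → m < s → diag P s ≈ 0#
    diag-above P>m s m<s = sumTo-zero N (λ a _ → P>m s m<s a)
    diagDx-above : ∀ {P m} → (∀ s → m < s → ∀ a → homog P s a ≈ 0#) → ∀ s → m < s → diagDx P s ≈ 0#
    diagDx-above P>m s m<s = sumTo-zero N (λ a _ → zeroʳ′ _ (P>m s m<s a))

module CurveCoefficients {c ℓ} (K : Field c ℓ) (p : ℕ) (a : Fin p → Fin p) (h : Fin p) where
  open Field K
  open FieldOps K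
  open Curve p a h
  open FiniteSums K
  open import Algebra.Properties.Ring ring using (-0#≈0#; +-inverseʳ-unique)
  open import Algebra.Properties.CommutativeSemigroup *-commutativeSemigroup
    using () renaming (x∙yz≈y∙xz to x*yz≈y*xz)
  open import Relation.Binary.Reasoning.Setoid setoid

  fcoeff-≥ : ∀ k → p ≤ k → fcoeff k ≈ 0#
  fcoeff-≥ k p≤k with k ℕ.<? p
  ... | yes k<p = ⊥-elim (ℕ.<-irrefl ≡.refl (ℕ.<-≤-trans k<p p≤k))
  ... | no _ = refl

  fcoeff-toℕ : ∀ i → fcoeff (toℕ i) ≈ ι (toℕ (a i))
  fcoeff-toℕ i with toℕ i ℕ.<? p
  ... | yes i<p = reflexive (≡.cong (λ i′ → ι (toℕ (a i′))) (fromℕ<-toℕ i i<p))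
  ... | no i≮p = ⊥-elim (i≮p (toℕ<n i))

  private
    -[0+0] : - (0# + 0#) ≈ 0#
    -[0+0] = trans (-‿cong (+-identityʳ 0#)) -0#≈0#

  curveCoeff-suc-0 : ∀ i → curveCoeff (suc i) 0 ≈ fcoeff (suc i)
  curveCoeff-suc-0 i = trans (+-cong refl -[0+0]) (+-identityʳ _)

  curveCoeff-0-suc : ∀ j → curveCoeff 0 (suc j) ≈ - fcoeff (suc j)
  curveCoeff-0-suc j = trans (+-cong refl (-‿cong (+-identityʳ _))) (+-identityˡ _)

  curveCoeff-suc-suc : ∀ i j → curveCoeff (suc i) (suc j) ≈ 0#
  curveCoeff-suc-suc i j = trans (+-cong refl -[0+0]) (+-identityʳ 0#)

  curveCoeff-0-0 : curveCoeff 0 0 ≈ - ι (toℕ h)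
  curveCoeff-0-0 = +-inverseʳ-unique _ _
    (trans (sym (+-assoc _ _ _)) (trans (+-cong (+-comm _ _) refl) (-‿inverseʳ _)))

  curveCoeff-> : ∀ i j → p < i ⊎ p < j → curveCoeff i j ≈ 0#
  curveCoeff-> (suc i) zero (inj₁ p<i) = trans (curveCoeff-suc-0 i) (fcoeff-≥ (suc i) (ℕ.<⇒≤ p<i))
  curveCoeff-> (suc i) (suc j) _ = curveCoeff-suc-suc i j
  curveCoeff-> zero (suc j) (inj₂ p<j) =
    trans (curveCoeff-0-suc j) (trans (-‿cong (fcoeff-≥ (suc j) (ℕ.<⇒≤ p<j))) -0#≈0#)
  curveCoeff-> (suc i) zero (inj₂ ())
  curveCoeff-> zero j (inj₁ ())

  coeff-curve : ∀ i j → coeff curve i j ≈ curveCoeff i j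
  coeff-curve i j with i ℕ.<? suc p | j ℕ.<? suc p
  ... | yes i≤p | yes j≤p = reflexive (≡.cong₂ curveCoeff (toℕ-fromℕ< i≤p) (toℕ-fromℕ< j≤p))
  ... | yes _ | no j≰p = sym (curveCoeff-> i j (inj₂ (ℕ.≮⇒≥ j≰p)))
  ... | no i≰p | _ = sym (curveCoeff-> i j (inj₁ (ℕ.≮⇒≥ i≰p)))

  -- x^i y^j lies in degree k + 1 exactly for (i , j) = (k + 1 , 0) and (0 , k + 1)
  δ-curveCoeff : ∀ k i j → δ (i ℕ.+ j) (suc k) * curveCoeff i j ≈
    δ i (suc k) * (δ j 0 * fcoeff (suc k)) + δ i 0 * (δ j (suc k) * - fcoeff (suc k))
  δ-curveCoeff k zero zero =
    trans (zeroˡ _) (sym (+-≈0 (zeroˡ _) (zeroʳ′ _ (zeroˡ _))))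
  δ-curveCoeff k (suc i) zero = begin
    δ (suc i ℕ.+ 0) (suc k) * curveCoeff (suc i) 0
      ≈⟨ *-cong (reflexive (≡.cong (λ n → δ n (suc k)) (ℕ.+-identityʳ (suc i)))) (curveCoeff-suc-0 i) ⟩
    δ (suc i) (suc k) * fcoeff (suc i)
      ≈⟨ δ-*-subst (suc i) (suc k) fcoeff ⟨
    δ (suc i) (suc k) * fcoeff (suc k)
      ≈⟨ +-identityʳ _ ⟨
    δ (suc i) (suc k) * fcoeff (suc k) + 0#
      ≈⟨ +-cong (*-cong refl (*-identityˡ _)) (zeroˡ _) ⟨
    δ (suc i) (suc k) * (1# * fcoeff (suc k)) + δ (suc i) 0 * (δ 0 (suc k) * - fcoeff (suc k)) ∎
  δ-curveCoeff k zero (suc j) = begin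
    δ (suc j) (suc k) * curveCoeff 0 (suc j)
      ≈⟨ *-cong refl (curveCoeff-0-suc j) ⟩
    δ (suc j) (suc k) * - fcoeff (suc j)
      ≈⟨ δ-*-subst (suc j) (suc k) (λ n → - fcoeff n) ⟨
    δ (suc j) (suc k) * - fcoeff (suc k)
      ≈⟨ trans (+-identityˡ _) (*-identityˡ _) ⟨
    0# + 1# * (δ (suc j) (suc k) * - fcoeff (suc k))
      ≈⟨ +-cong (zeroˡ _) refl ⟨
    δ 0 (suc k) * (δ (suc j) 0 * fcoeff (suc k)) + 1# * (δ (suc j) (suc k) * - fcoeff (suc k)) ∎
  δ-curveCoeff k (suc i) (suc j) =
    trans (zeroʳ′ _ (curveCoeff-suc-suc i j)) (sym (+-≈0 (zeroʳ′ _ (zeroˡ _)) (zeroˡ _)))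

  module _ (N : ℕ) (p<N : p < N) where
    open HomogeneousComponents K N

    homog-curve : ∀ k i → suc k < N →
      homog (coeff curve) (suc k) i ≈ δ i (suc k) * fcoeff (suc k) + δ i 0 * - fcoeff (suc k)
    homog-curve k i k<N = begin
      sumTo N (λ j → δ (i ℕ.+ j) (suc k) * coeff curve i j)
        ≈⟨ sumTo-cong N (λ j → trans (*-cong refl (coeff-curve i j)) (δ-curveCoeff k i j)) ⟩
      sumTo N (λ j → δ i (suc k) * (δ j 0 * A) + δ i 0 * (δ j (suc k) * - A))
        ≈⟨ sumTo-+ N _ _ ⟩
      sumTo N (λ j → δ i (suc k) * (δ j 0 * A)) + sumTo N (λ j → δ i 0 * (δ j (suc k) * - A))
        ≈⟨ +-cong (*-distribˡ-sumTo N _ _) (*-distribˡ-sumTo N _ _) ⟨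
      δ i (suc k) * sumTo N (λ j → δ j 0 * A) + δ i 0 * sumTo N (λ j → δ j (suc k) * - A)
        ≈⟨ +-cong (*-cong refl (sumTo-δ′ N 0 _ (ℕ.≤-<-trans z≤n k<N))) (*-cong refl (sumTo-δ′ N (suc k) _ k<N)) ⟩
      δ i (suc k) * A + δ i 0 * - A ∎
      where
      A = fcoeff (suc k)

    homog-curve-≈0 : ∀ k i → fcoeff (suc k) ≈ 0# → homog (coeff curve) (suc k) i ≈ 0#
    homog-curve-≈0 k i A≈0 = sumTo-zero N (λ j _ →
      trans (*-cong refl (coeff-curve i j)) (trans (δ-curveCoeff k i j)
        (+-≈0 (zeroʳ′ _ (zeroʳ′ _ A≈0)) (zeroʳ′ _ (zeroʳ′ _ (trans (-‿cong A≈0) -0#≈0#))))))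

    diag-curve-suc : ∀ k → 1 ≤ k → diag (coeff curve) k ≈ 0#
    diag-curve-suc (suc k) _ with suc k ℕ.<? p
    ... | no k≮p = sumTo-zero N (λ i _ → homog-curve-≈0 k i (fcoeff-≥ (suc k) (ℕ.≮⇒≥ k≮p)))
    ... | yes k<p = begin
      sumTo N (homog (coeff curve) (suc k))
        ≈⟨ sumTo-cong N (λ i → homog-curve k i k<N) ⟩
      sumTo N (λ i → δ i (suc k) * A + δ i 0 * - A)
        ≈⟨ sumTo-+ N _ _ ⟩
      sumTo N (λ i → δ i (suc k) * A) + sumTo N (λ i → δ i 0 * - A)
        ≈⟨ +-cong (sumTo-δ′ N (suc k) _ k<N) (sumTo-δ′ N 0 _ (ℕ.≤-<-trans z≤n k<N)) ⟩
      A + - A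
        ≈⟨ -‿inverseʳ A ⟩
      0# ∎
      where
      A = fcoeff (suc k)
      k<N = ℕ.<-trans k<p p<N

    diagDx-curve-suc : ∀ k → suc k < p → diagDx (coeff curve) (suc k) ≈ ι (suc k) * fcoeff (suc k)
    diagDx-curve-suc k k<p = begin
      sumTo N (λ i → ι i * homog (coeff curve) (suc k) i)
        ≈⟨ sumTo-cong N (λ i → trans (*-cong refl (homog-curve k i k<N))
             (trans (distribˡ _ _ _) (+-cong (x*yz≈y*xz _ _ _) (x*yz≈y*xz _ _ _)))) ⟩
      sumTo N (λ i → δ i (suc k) * (ι i * A) + δ i 0 * (ι i * - A))
        ≈⟨ sumTo-+ N _ _ ⟩
      sumTo N (λ i → δ i (suc k) * (ι i * A)) + sumTo N (λ i → δ i 0 * (ι i * - A))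
        ≈⟨ +-cong (sumTo-δ′ N (suc k) _ k<N) (sumTo-δ′ N 0 _ (ℕ.≤-<-trans z≤n k<N)) ⟩
      ι (suc k) * A + 0# * - A
        ≈⟨ trans (+-cong refl (zeroˡ _)) (+-identityʳ _) ⟩
      ι (suc k) * A ∎
      where
      A = fcoeff (suc k)
      k<N = ℕ.<-trans k<p p<N

    diag-curve-zero : diag (coeff curve) 0 ≈ - ι (toℕ h)
    diag-curve-zero =
      trans (diag-zero (coeff curve) (ℕ.≤-<-trans z≤n p<N)) (trans (coeff-curve 0 0) curveCoeff-0-0)

module CurveIrreducibility {c ℓ} (K : Field c ℓ) {p : ℕ} (p-prime : Prime p)
  (ιp≈0 : Field._≈_ K (FieldOps.ι K p) (Field.0# K))
  (a : Fin p → Fin p) (h : Fin p) (h≢0 : ¬ toℕ h ≡ 0) where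
  open Field K
  open FieldOps K
  open Curve p a h
  open CurveCoefficients K p a h
  open Characteristic K using (ι-nonzero)
  open FieldProperties K using (*-nonzero)
  open import Algebra.Properties.Ring ring using (-0#≈0#; -‿injective)

  curve-nonconstant : (∃ λ i → 1 ≤ toℕ i × ¬ toℕ (a i) ≡ 0) → Nonconstant curve
  curve-nonconstant (i , 1≤i , ai≢0) =
    toℕ i , 0 , (λ (i≡0 , _) → ℕ.<-irrefl (≡.sym i≡0) 1≤i) ,
    ι-nonzero p-prime ιp≈0 {{ℕ.≢-nonZero ai≢0}} (toℕ<n (a i)) ∘
      trans (sym (trans (coeff-curve (toℕ i) 0) (trans (curveCoeff-x (toℕ i) 1≤i) (fcoeff-toℕ i))))
    where
    curveCoeff-x : ∀ n → 1 ≤ n → curveCoeff n 0 ≈ fcoeff n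
    curveCoeff-x (suc n) _ = curveCoeff-suc-0 n

  curve-no-factors : ∀ G H → IsProduct curve G H → ¬ (Nonconstant G × Nonconstant H)
  curve-no-factors G H curve≈GH =
    no-nonconstant-factors (coeff curve) (coeff G) (coeff H)
      (coeff-supported curve p<N) G-supported H-supported
      (λ i j → trans (curve≈GH i j) (mulCoeff-conv₂ G H G-supported H-supported i j))
      (diag-curve-suc N p<N) diag-curve-0≉0 diagDx-curve≉0
    where
    N : ℕ
    N = suc (bound G ℕ.+ bound H ℕ.+ p)
    open HomogeneousComponents K N
    p<N : p < N
    p<N = s≤s (ℕ.m≤n+m p _)
    G-supported : Supported (coeff G)
    G-supported = coeff-supported G (s≤s (ℕ.≤-trans (ℕ.m≤m+n _ _) (ℕ.m≤m+n _ p)))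
    H-supported : Supported (coeff H)
    H-supported = coeff-supported H (s≤s (ℕ.≤-trans (ℕ.m≤n+m _ (bound G)) (ℕ.m≤m+n _ p)))
    diag-curve-0≉0 : ¬ diag (coeff curve) 0 ≈ 0#
    diag-curve-0≉0 diag≈0 = ι-nonzero p-prime ιp≈0 {{ℕ.≢-nonZero h≢0}} (toℕ<n h)
      (-‿injective (trans (sym (diag-curve-zero N p<N)) (trans diag≈0 (sym -0#≈0#))))
    diagDx-curve≉0 : ∀ k i → 1 ≤ k → ¬ homog (coeff curve) k i ≈ 0# → ¬ diagDx (coeff curve) k ≈ 0#
    diagDx-curve≉0 (suc k) i _ homog≉0 with suc k ℕ.<? p
    ... | no k≮p = ⊥-elim (homog≉0 (homog-curve-≈0 N p<N k i (fcoeff-≥ (suc k) (ℕ.≮⇒≥ k≮p))))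
    ... | yes k<p = *-nonzero (ι-nonzero p-prime ιp≈0 k<p) (homog≉0 ∘ homog-curve-≈0 N p<N k i)
                    ∘ trans (sym (diagDx-curve-suc N p<N k k<p))

  curve-irreducible : (∃ λ i → 1 ≤ toℕ i × ¬ toℕ (a i) ≡ 0) → Irreducible curve
  curve-irreducible a-nonconstant = curve-nonconstant a-nonconstant , curve-no-factors

lemma10 : ∀ {c ℓ : Level} (p : ℕ) → Prime p →
    (a : Fin p → Fin p) → (∃ λ i → 1 ≤ toℕ i × ¬ (toℕ (a i) ≡ 0)) →
    (h : Fin p) → ¬ (toℕ h ≡ 0) →
    (K : Field c ℓ) → FieldOps.AlgClosed K →
    Field._≈_ K (FieldOps.ι K p) (Field.0# K) →
    FieldOps.Irreducible K (FieldOps.Curve.curve K p a h)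
lemma10 p p-prime a a-nonconstant h h≢0 K _ ιp≈0 =
  CurveIrreducibility.curve-irreducible K p-prime ιp≈0 a h h≢0 a-nonconstant
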